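{- Let $m \ge 4$ be an integer and let $G = P_4 \mathbin{\Box} P_m$. Then \[ m(G,3) \le \begin{cases} \left\lfloor \frac{5(m+1)}{3} \right\rfloor + 1, & m \in \{5,7,11\},\\[2pt] \left\lfloor \frac{5(m+1)}{3} \right\rfloor + 2, & \text{otherwise}. \end{cases} \]
   Context: For a graph $G$ and an integer $r \ge 2$, the $r$-neighbor bootstrap percolation process starting from a set $A_0 \subseteq V(G)$ of initially infected vertices is defined by $A_t = A_{t-1} \cup \{ v \in V(G) : |N_G(v) \cap A_{t-1}| \ge r\}$ for $t \ge 1$. The set $A_0$ is $r$-percolating if $\bigcup_{t \ge 0} A_t = V(G)$. The $r$-percolation number $m(G,r)$ is the minimum cardinality of an $r$-percolating set of $G$. $P_n$ denotes the path on $n$ vertices and $\mathbin{\Box}$ denotes the Cartesian product of graphs, so $P_n \mathbin{\Box} P_m$ is the $n \times m$ grid graph. -}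

module Defs where

open import Data.Nat using (ℕ; zero; suc; _+_; _*_; _≤_; _/_)
open import Data.Bool using (Bool; true; false; _∧_; _∨_; if_then_else_)
open import Data.Fin using (Fin; toℕ; remQuot)
open import Data.Fin.Subset using (Subset; _∈_; ∣_∣; inside; outside)
open import Data.Vec using (Vec; tabulate; lookup)
open import Data.List using (List; map; allFin)
open import Data.Nat.ListAction using (sum)
open import Data.Product using (_×_; _,_; ∃-syntax; Σ-syntax)
open import Relation.Nullary.Decidable using (⌊_⌋)
open import Relation.Binary.PropositionalEquality using (_≡_)
import Data.Fin.Subset.Properties
import Data.Nat

-- A finite graph on the vertex set Fin N, with Boolean adjacency.
-- (Only used for the grid below, whose adjacency is symmetric and irreflexive.)
record Graph : Set where
  field
    N        : ℕ
    adj      : Fin N → Fin N → Bool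
open Graph public

pathAdj : ℕ → ℕ → Bool
pathAdj i j = ⌊ suc i Data.Nat.≟ j ⌋ ∨ ⌊ suc j Data.Nat.≟ i ⌋

-- Grid P_n □ P_m on Fin (n * m); vertex x corresponds to (i , j) = remQuot m x.
-- (i , j) ~ (i' , j') iff (i = i' and j ~ j' in P_m) or (j = j' and i ~ i' in P_n).
gridAdj : (n m : ℕ) → Fin (n * m) → Fin (n * m) → Bool
gridAdj n m x y with remQuot {n} m x | remQuot {n} m y
... | i , j | i' , j' =
  (⌊ toℕ i Data.Nat.≟ toℕ i' ⌋ ∧ pathAdj (toℕ j) (toℕ j'))
  ∨ (⌊ toℕ j Data.Nat.≟ toℕ j' ⌋ ∧ pathAdj (toℕ i) (toℕ i'))

Grid : ℕ → ℕ → Graph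
Grid n m = record { N = n * m ; adj = gridAdj n m }

nbrCount : (G : Graph) → Subset (N G) → Fin (N G) → ℕ
nbrCount G A v =
  sum (map (λ u → if adj G v u ∧ ⌊ Data.Fin.Subset.Properties._∈?_ u A ⌋ then 1 else 0)
           (allFin (N G)))

step : (G : Graph) → ℕ → Subset (N G) → Subset (N G)
step G r A = tabulate λ v →
  if ⌊ Data.Fin.Subset.Properties._∈?_ v A ⌋ ∨ ⌊ r Data.Nat.≤? nbrCount G A v ⌋
  then inside else outside

infected : (G : Graph) → ℕ → Subset (N G) → ℕ → Subset (N G)
infected G r A₀ zero    = A₀
infected G r A₀ (suc t) = step G r (infected G r A₀ t)

Percolating : (G : Graph) → ℕ → Subset (N G) → Set
Percolating G r A₀ = ∀ (v : Fin (N G)) → ∃[ t ] (v ∈ infected G r A₀ t)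

-- m(G, r) ≤ k  (m(G,r) is the minimum size of an r-percolating set; the full
-- vertex set percolates, so the minimum exists and m(G,r) ≤ k iff some
-- r-percolating set has size ≤ k)
PercNumberAtMost : (G : Graph) → ℕ → ℕ → Set
PercNumberAtMost G r k = Σ[ A₀ ∈ Subset (N G) ] (Percolating G r A₀ × ∣ A₀ ∣ ≤ k)

-- For m = 6B + 3 + w with 1 ≤ w ≤ 6, the seed consists of a left cap of three columns, B copies
-- of a six-column block carrying ten seeds, and a right cap of width w with c cells.  It has
-- 10B + 6 + c cells, while ⌊5(m+1)/3⌋ = 10B + ⌊5(w+4)/3⌋, so the bound only has to be checked
-- for the six caps.
-- Bootstrap percolation is monotone under graph embeddings, so a finite computation on a narrow
-- window of the grid, whose leftmost columns are taken as already infected, transfers to the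
-- whole grid at any horizontal offset.  One window shows that the left cap and the first block
-- infect the first six columns, a second that every further block pushes the infected prefix six
-- columns to the right, and a third that the last block and the right cap finish the grid.
-- Seeds without blocks (m ≤ 9), and a separate seed for the exceptional width m = 7, are checked
-- directly.
module Submission where

open import Defs
open import Data.Nat using (ℕ; _+_; _*_; _/_; _≤_)
open import Data.Sum using (_⊎_)
open import Data.Product using (_×_)
open import Relation.Binary.PropositionalEquality using (_≡_)
open import Relation.Nullary using (¬_)

open import Data.Nat.Properties
  using (+-0-commutativeMonoid; +-commutativeSemigroup; module ≤-Reasoning; +-assoc; +-comm; +-suc;
         ≤-refl; ≤-trans; ≤-reflexive; <-≤-trans; ≮⇒≥; +-mono-≤; +-monoʳ-≤; +-monoʳ-<;
         +-cancelˡ-<; m+[n∸m]≡n; m≤m+n; <ᵇ⇒<; <⇒<ᵇ)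
open import Algebra.Properties.CommutativeMonoid.Sum +-0-commutativeMonoid
  using (sum; sum-remove; sum-cong-≗; ∑-distrib-+)
open import Algebra.Properties.CommutativeSemigroup +-commutativeSemigroup using (x∙yz≈y∙xz)
open import Data.Bool using (Bool; true; false; T; _∧_; _∨_; if_then_else_)
open import Data.Bool.Properties using (T-≡; T-∧; T-∨)
open import Data.Empty using (⊥-elim)
open import Data.Fin using (Fin; zero; suc; toℕ; fromℕ<; punchIn; punchOut; combine; remQuot; inject≤; _↑ʳ_)
open import Data.Fin.Patterns using (0F; 1F; 2F; 3F; 4F; 5F)
open import Data.Fin.Properties
  using (0≢1+n; suc-injective; punchOut-injective; punchIn-punchOut; toℕ-inject≤; toℕ-↑ʳ; inject≤-injective;
         ↑ʳ-injective; combine-injective; combine-remQuot; remQuot-combine; toℕ-fromℕ<; toℕ-injective; toℕ<n;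
         all?)
open import Data.Fin.Subset using (Subset; _∈_; _⊆_; inside; outside; ⊤; ∣_∣)
open import Data.Fin.Subset.Properties using (_∈?_; ∈⊤; _⊆?_)
import Data.List as List
open import Data.List.Properties using (map-tabulate)
open import Data.Nat using (zero; suc; z≤n; s≤s; _<_; _∸_; _%_; _≤?_; _<?_; _≟_; _<ᵇ_; NonZero)
open import Data.Nat.DivMod using (m*n/n≡m; +-distrib-/-∣ˡ; m≡m%n+[m/n]*n; m%n<n)
open import Data.Nat.Divisibility using (divides)
open import Data.Nat.ListAction using () renaming (sum to listSum)
open import Data.Nat.Tactic.RingSolver using (solve-∀)
open import Data.Product using (∃-syntax; _,_; proj₁; proj₂)
open import Data.Sum using (inj₁; inj₂; [_,_]′)
import Data.Sum as Sum
open import Data.Unit using (tt)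
open import Data.Vec using (lookup; tabulate; concat; _++_; []; _∷_)
open import Data.Vec.Properties using ([]=⇒lookup; lookup⇒[]=; lookup∘tabulate; lookup-concat)
open import Function using (_∘_; id; _⇔_; mk⇔; Equivalence; Injective)
open import Relation.Binary.PropositionalEquality
  using (refl; sym; trans; cong; cong-app; cong₂; subst; subst₂; _≢_; module ≡-Reasoning)
open import Relation.Nullary using (yes; no)
open import Relation.Nullary.Decidable using (⌊_⌋; ⌊⌋-map′; toWitness; fromWitness)

open Equivalence using (to; from)

-- Finite sums

sum-tabulate : ∀ {n} (g : Fin n → ℕ) → listSum (List.tabulate g) ≡ sum g
sum-tabulate {zero}  g = refl
sum-tabulate {suc n} g = cong (g zero +_) (sum-tabulate (g ∘ suc))

sum-map-allFin : ∀ n (g : Fin n → ℕ) → listSum (List.map g (List.allFin n)) ≡ sum g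
sum-map-allFin n g = trans (cong listSum (map-tabulate id g)) (sum-tabulate g)

sum-≤-injective : ∀ {m n} (f : Fin m → Fin n) → Injective _≡_ _≡_ f →
                  (g : Fin m → ℕ) (h : Fin n → ℕ) → (∀ x → g x ≤ h (f x)) → sum g ≤ sum h
sum-≤-injective {zero}          f f-inj g h g≤hf = z≤n
sum-≤-injective {suc m} {zero}  f f-inj g h g≤hf with () ← f zero
sum-≤-injective {suc m} {suc n} f f-inj g h g≤hf = begin
  g zero + sum (g ∘ suc)      ≤⟨ +-mono-≤ (g≤hf zero) (sum-≤-injective f′ f′-inj (g ∘ suc) (h ∘ punchIn p) g≤hf′) ⟩
  h p + sum (h ∘ punchIn p)   ≡⟨ sum-remove {i = p} h ⟨
  sum h                       ∎
  where
  open ≤-Reasoning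
  p = f zero
  p≢ : ∀ x → p ≢ f (suc x)
  p≢ x = 0≢1+n ∘ f-inj
  f′ : Fin m → Fin n
  f′ x = punchOut (p≢ x)
  f′-inj : Injective _≡_ _≡_ f′
  f′-inj eq = suc-injective (f-inj (punchOut-injective (p≢ _) (p≢ _) eq))
  g≤hf′ : ∀ x → g (suc x) ≤ h (punchIn p (f′ x))
  g≤hf′ x = subst (λ y → g (suc x) ≤ h y) (sym (punchIn-punchOut (p≢ x))) (g≤hf (suc x))

-- Monotonicity of bootstrap percolation under graph embeddings

∈⇔T-lookup : ∀ {n} {x : Fin n} {p : Subset n} → x ∈ p ⇔ T (lookup p x)
∈⇔T-lookup {x = x} {p} = mk⇔ (from T-≡ ∘ []=⇒lookup) (lookup⇒[]= x p ∘ to T-≡)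

if-true-false : ∀ b → (if b then true else false) ≡ b
if-true-false true  = refl
if-true-false false = refl

module _ {G : Graph} {r : ℕ} {A : Subset (N G)} where

  lookup-step : ∀ v → lookup (step G r A) v ≡ ⌊ v ∈? A ⌋ ∨ ⌊ r ≤? nbrCount G A v ⌋
  lookup-step v = trans (lookup∘tabulate _ v) (if-true-false _)

  ∈-step⁻ : ∀ {v} → v ∈ step G r A → v ∈ A ⊎ r ≤ nbrCount G A v
  ∈-step⁻ {v} = Sum.map (toWitness {a? = v ∈? A}) (toWitness {a? = r ≤? _})
              ∘ to T-∨ ∘ subst T (lookup-step v) ∘ to ∈⇔T-lookup

  ∈-step⁺ : ∀ {v} → v ∈ A ⊎ r ≤ nbrCount G A v → v ∈ step G r A
  ∈-step⁺ {v} = from ∈⇔T-lookup ∘ subst T (sym (lookup-step v)) ∘ from T-∨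
              ∘ Sum.map (fromWitness {a? = v ∈? A}) (fromWitness {a? = r ≤? _})

module _ {G : Graph} {r : ℕ} {A : Subset (N G)} where

  ⊆-infected : ∀ t → A ⊆ infected G r A t
  ⊆-infected zero    = id
  ⊆-infected (suc t) = ∈-step⁺ ∘ inj₁ ∘ ⊆-infected t

  infected-⊆-+ : ∀ s {t} → infected G r A t ⊆ infected G r A (s + t)
  infected-⊆-+ zero    = id
  infected-⊆-+ (suc s) = ∈-step⁺ ∘ inj₁ ∘ infected-⊆-+ s

⊤⊆infected⇒percolating : ∀ G r A t → ⊤ ⊆ infected G r A t → Percolating G r A
⊤⊆infected⇒percolating G r A t ⊤⊆ v = t , ⊤⊆ ∈⊤

record Embedding (H G : Graph) : Set where
  field
    embed           : Fin (N H) → Fin (N G)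
    embed-injective : Injective _≡_ _≡_ embed
    embed-adj       : ∀ {u v} → T (adj H u v) → T (adj G (embed u) (embed v))

indicator-mono : ∀ {a b} → (T a → T b) → (if a then 1 else 0) ≤ (if b then 1 else 0)
indicator-mono {false}         _   = z≤n
indicator-mono {true}  {true}  _   = ≤-refl
indicator-mono {true}  {false} a⇒b = ⊥-elim (a⇒b tt)

module _ {H G : Graph} (e : Embedding H G) where
  open Embedding e

  MapsInto : Subset (N H) → Subset (N G) → Set
  MapsInto X Y = ∀ {v} → v ∈ X → embed v ∈ Y

  nbrCount-embed : ∀ {X Y} → MapsInto X Y → ∀ v → nbrCount H X v ≤ nbrCount G Y (embed v)
  nbrCount-embed {X} {Y} X↦Y v =
    subst₂ _≤_ (sym (sum-map-allFin (N H) _)) (sym (sum-map-allFin (N G) _))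
      (sum-≤-injective embed embed-injective _ _ (λ u → indicator-mono (pointwise u)))
    where
    pointwise : ∀ u → T (adj H v u ∧ ⌊ u ∈? X ⌋) → T (adj G (embed v) (embed u) ∧ ⌊ embed u ∈? Y ⌋)
    pointwise u vu =
      let (v~u , u∈X) = to T-∧ vu
      in from T-∧ (embed-adj v~u , fromWitness {a? = embed u ∈? Y} (X↦Y (toWitness {a? = u ∈? X} u∈X)))

  step-embed : ∀ {r X Y} → MapsInto X Y → MapsInto (step H r X) (step G r Y)
  step-embed X↦Y {v} = ∈-step⁺ ∘ Sum.map X↦Y (λ r≤ → ≤-trans r≤ (nbrCount-embed X↦Y v)) ∘ ∈-step⁻

  infected-embed : ∀ {r A′ A t} → MapsInto A′ (infected G r A t) →
                   ∀ s → MapsInto (infected H r A′ s) (infected G r A (s + t))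
  infected-embed A′↦A zero    = A′↦A
  infected-embed A′↦A (suc s) = step-embed (infected-embed A′↦A s)

-- Shifting the columns of a grid

-- Not definitional: ⌊_⌋ is stuck on the map′ in the definition of _≟_.
≟-suc : ∀ a b → ⌊ suc a ≟ suc b ⌋ ≡ ⌊ a ≟ b ⌋
≟-suc a b = trans (⌊⌋-map′ _ _ _) (sym (⌊⌋-map′ _ _ _))

≟-shift : ∀ c a b → ⌊ c + a ≟ c + b ⌋ ≡ ⌊ a ≟ b ⌋
≟-shift zero    a b = refl
≟-shift (suc c) a b = trans (≟-suc (c + a) (c + b)) (≟-shift c a b)

pathAdj-shift : ∀ c a b → pathAdj (c + a) (c + b) ≡ pathAdj a b
pathAdj-shift zero    a b = refl
pathAdj-shift (suc c) a b =
  trans (cong₂ _∨_ (≟-suc (suc (c + a)) (c + b)) (≟-suc (suc (c + b)) (c + a))) (pathAdj-shift c a b)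

cellAdj : ℕ → ℕ → ℕ → ℕ → Bool
cellAdj i j i′ j′ = (⌊ i ≟ i′ ⌋ ∧ pathAdj j j′) ∨ (⌊ j ≟ j′ ⌋ ∧ pathAdj i i′)

cellAdj-shiftʳ : ∀ c i j i′ j′ → cellAdj i (c + j) i′ (c + j′) ≡ cellAdj i j i′ j′
cellAdj-shiftʳ c i j i′ j′ =
  cong₂ _∨_ (cong (⌊ i ≟ i′ ⌋ ∧_) (pathAdj-shift c j j′)) (cong (_∧ pathAdj i i′) (≟-shift c j j′))

gridAdj-combine : ∀ {n m} (i i′ : Fin n) (j j′ : Fin m) →
                  gridAdj n m (combine i j) (combine i′ j′) ≡ cellAdj (toℕ i) (toℕ j) (toℕ i′) (toℕ j′)
gridAdj-combine {n} {m} i i′ j j′ =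
  cong₂ (λ (p q : Fin n × Fin m) → cellAdj (toℕ (proj₁ p)) (toℕ (proj₂ p)) (toℕ (proj₁ q)) (toℕ (proj₂ q)))
        (remQuot-combine i j) (remQuot-combine i′ j′)

module _ {w m : ℕ} (c : ℕ) (c+w≤m : c + w ≤ m) where

  shiftCol : Fin w → Fin m
  shiftCol j = inject≤ (c ↑ʳ j) c+w≤m

  toℕ-shiftCol : ∀ j → toℕ (shiftCol j) ≡ c + toℕ j
  toℕ-shiftCol j = trans (toℕ-inject≤ (c ↑ʳ j) c+w≤m) (toℕ-↑ʳ c j)

  shiftCol-injective : Injective _≡_ _≡_ shiftCol
  shiftCol-injective eq = ↑ʳ-injective c _ _ (inject≤-injective c+w≤m c+w≤m _ _ eq)

  shiftCol-preimage : ∀ {hi} (j : Fin m) → c ≤ toℕ j → toℕ j < c + hi → hi ≤ w →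
                      ∃[ x ] shiftCol x ≡ j × toℕ x < hi
  shiftCol-preimage {hi} j c≤j j<c+hi hi≤w = x , toℕ-injective toℕ-shiftCol-x , subst (_< hi) (sym toℕ-x) d<hi
    where
    d<hi : toℕ j ∸ c < hi
    d<hi = +-cancelˡ-< c _ hi (subst (_< c + hi) (sym (m+[n∸m]≡n c≤j)) j<c+hi)
    x : Fin w
    x = fromℕ< (<-≤-trans d<hi hi≤w)
    toℕ-x : toℕ x ≡ toℕ j ∸ c
    toℕ-x = toℕ-fromℕ< (<-≤-trans d<hi hi≤w)
    toℕ-shiftCol-x : toℕ (shiftCol x) ≡ toℕ j
    toℕ-shiftCol-x = trans (toℕ-shiftCol x) (trans (cong (c +_) toℕ-x) (m+[n∸m]≡n c≤j))

  shiftColumns : ∀ n → Embedding (Grid n w) (Grid n m)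
  shiftColumns n = record
    { embed           = embed
    ; embed-injective = embed-injective
    ; embed-adj       = λ {x} {y} → subst T (sym (embed-adj≡ x y))
    }
    where
    embed : Fin (n * w) → Fin (n * m)
    embed x = combine (proj₁ (remQuot {n} w x)) (shiftCol (proj₂ (remQuot {n} w x)))

    embed-injective : Injective _≡_ _≡_ embed
    embed-injective {x} {y} eq = begin
      x               ≡⟨ combine-remQuot {n} w x ⟨
      combine i j     ≡⟨ cong₂ combine i≡i′ (shiftCol-injective sj≡sj′) ⟩
      combine i′ j′   ≡⟨ combine-remQuot {n} w y ⟩
      y               ∎
      where
      open ≡-Reasoning
      i  = proj₁ (remQuot {n} w x)
      j  = proj₂ (remQuot {n} w x)
      i′ = proj₁ (remQuot {n} w y)
      j′ = proj₂ (remQuot {n} w y)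
      i≡i′ = proj₁ (combine-injective i (shiftCol j) i′ (shiftCol j′) eq)
      sj≡sj′ = proj₂ (combine-injective i (shiftCol j) i′ (shiftCol j′) eq)

    embed-adj≡ : ∀ x y → gridAdj n m (embed x) (embed y) ≡ gridAdj n w x y
    embed-adj≡ x y = begin
      gridAdj n m (combine i (shiftCol j)) (combine i′ (shiftCol j′))
        ≡⟨ gridAdj-combine i i′ (shiftCol j) (shiftCol j′) ⟩
      cellAdj (toℕ i) (toℕ (shiftCol j)) (toℕ i′) (toℕ (shiftCol j′))
        ≡⟨ cong₂ (λ a b → cellAdj (toℕ i) a (toℕ i′) b) (toℕ-shiftCol j) (toℕ-shiftCol j′) ⟩
      cellAdj (toℕ i) (c + toℕ j) (toℕ i′) (c + toℕ j′)
        ≡⟨ cellAdj-shiftʳ c (toℕ i) (toℕ j) (toℕ i′) (toℕ j′) ⟩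
      gridAdj n w x y
        ∎
      where
      open ≡-Reasoning
      i  = proj₁ (remQuot {n} w x)
      j  = proj₂ (remQuot {n} w x)
      i′ = proj₁ (remQuot {n} w y)
      j′ = proj₂ (remQuot {n} w y)

shiftColumns-combine : ∀ {n w m} c (fits : c + w ≤ m) (i : Fin n) (x : Fin w) →
                       Embedding.embed (shiftColumns c fits n) (combine i x) ≡ combine i (shiftCol c fits x)
shiftColumns-combine {n} {w} c fits i x =
  cong (λ (q : Fin n × Fin w) → combine (proj₁ q) (shiftCol c fits (proj₂ q))) (remQuot-combine i x)

-- Seed patterns and windows

-- Indexed by column first, so that beside juxtaposes patterns horizontally.
Pattern : Set
Pattern = ℕ → ℕ → Bool

fromPattern : (n w : ℕ) → Pattern → Subset (n * w)
fromPattern n w p = concat (tabulate {n = n} λ i → tabulate {n = w} λ j → p (toℕ j) (toℕ i))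

∈-fromPattern : ∀ {n w p} (i : Fin n) (j : Fin w) → combine i j ∈ fromPattern n w p ⇔ T (p (toℕ j) (toℕ i))
∈-fromPattern {n} {w} {p} i j = subst (λ b → combine i j ∈ fromPattern n w p ⇔ T b) lookup≡ ∈⇔T-lookup
  where
  lookup≡ : lookup (fromPattern n w p) (combine i j) ≡ p (toℕ j) (toℕ i)
  row : Fin n → Subset w
  row i = tabulate λ j → p (toℕ j) (toℕ i)
  lookup≡ = trans (lookup-concat (tabulate row) i j)
                  (trans (cong (λ r → lookup r j) (lookup∘tabulate row i)) (lookup∘tabulate (λ j → p (toℕ j) (toℕ i)) j))

beside : ℕ → Pattern → Pattern → Pattern
beside zero    p q x       = q x
beside (suc w) p q zero    = p zero
beside (suc w) p q (suc x) = beside w (p ∘ suc) q x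

∅ᴾ : Pattern
∅ᴾ _ _ = false

_∪ᴾ_ : Pattern → Pattern → Pattern
(p ∪ᴾ q) x i = p x i ∨ q x i

firstColumns : ℕ → Pattern
firstColumns c x _ = x <ᵇ c

_⊆ᴾ_ : Pattern → Pattern → Set
p ⊆ᴾ q = ∀ x i → T (p x i) → T (q x i)

∅ᴾ-⊆ᴾ : ∀ {p} → ∅ᴾ ⊆ᴾ p
∅ᴾ-⊆ᴾ x i ()

beside-monoʳ : ∀ w p {q q′} → q ⊆ᴾ q′ → beside w p q ⊆ᴾ beside w p q′
beside-monoʳ zero    p q⊆q′ = q⊆q′
beside-monoʳ (suc w) p q⊆q′ zero    i = id
beside-monoʳ (suc w) p q⊆q′ (suc x) i = beside-monoʳ w (p ∘ suc) q⊆q′ x i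

trues : ℕ → (ℕ → Bool) → ℕ
trues zero    f = 0
trues (suc w) f = (if f 0 then 1 else 0) + trues w (f ∘ suc)

cells : ℕ → ℕ → Pattern → ℕ
cells n w p = sum λ (i : Fin n) → trues w λ x → p x (toℕ i)

∣p++q∣ : ∀ {a b} (p : Subset a) (q : Subset b) → ∣ p ++ q ∣ ≡ ∣ p ∣ + ∣ q ∣
∣p++q∣ []            q = refl
∣p++q∣ (inside ∷ p)  q = cong suc (∣p++q∣ p q)
∣p++q∣ (outside ∷ p) q = ∣p++q∣ p q

∣tabulate∣ : ∀ w (f : ℕ → Bool) → ∣ tabulate {n = w} (f ∘ toℕ) ∣ ≡ trues w f
∣tabulate∣ zero    f = refl
∣tabulate∣ (suc w) f with f 0
... | true  = cong suc (∣tabulate∣ w (f ∘ suc))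
... | false = ∣tabulate∣ w (f ∘ suc)

∣fromPattern∣ : ∀ n w p → ∣ fromPattern n w p ∣ ≡ cells n w p
∣fromPattern∣ zero    w p = refl
∣fromPattern∣ (suc n) w p =
  trans (∣p++q∣ (tabulate {n = w} λ j → p (toℕ j) 0) (fromPattern n w (λ x i → p x (suc i))))
        (cong₂ _+_ (∣tabulate∣ w (λ x → p x 0)) (∣fromPattern∣ n w (λ x i → p x (suc i))))

trues-beside : ∀ w {v} p q i →
               trues (w + v) (λ x → beside w p q x i) ≡ trues w (λ x → p x i) + trues v (λ x → q x i)
trues-beside zero    p q i = refl
trues-beside (suc w) {v} p q i =
  trans (cong (pᵢ₀ +_) (trues-beside w (p ∘ suc) q i)) (sym (+-assoc pᵢ₀ (trues w _) (trues v _)))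
  where pᵢ₀ = if p 0 i then 1 else 0

cells-beside : ∀ n w v p q → cells n (w + v) (beside w p q) ≡ cells n w p + cells n v q
cells-beside n w v p q = trans (sum-cong-≗ {n} (λ i → trues-beside w {v} p q (toℕ i))) (∑-distrib-+ {n} _ _)

InfectsFirstColumns : (r n w : ℕ) → Pattern → (t hi : ℕ) → Set
InfectsFirstColumns r n w s t hi = fromPattern n w (firstColumns hi) ⊆ infected (Grid n w) r (fromPattern n w s) t

module Columns (n m r : ℕ) (p : Pattern) where

  InfectedBefore : ℕ → ℕ → Set
  InfectedBefore t c = ∀ (i : Fin n) (j : Fin m) → toℕ j < c → combine i j ∈ infected (Grid n m) r (fromPattern n m p) t

  window-seeds : ∀ {w} c d (fits : c + w ≤ m) s {t} → s ⊆ᴾ (λ x → p (c + x)) → InfectedBefore t (c + d) →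
                 MapsInto (shiftColumns c fits n) (fromPattern n w (firstColumns d ∪ᴾ s))
                          (infected (Grid n m) r (fromPattern n m p) t)
  window-seeds {w} c d fits s {t} s⊆p before {u} u∈ =
    seed-cell (proj₁ (remQuot {n} w u)) (proj₂ (remQuot {n} w u))
      (to (∈-fromPattern {n} {w} {firstColumns d ∪ᴾ s} _ _)
          (subst (_∈ fromPattern n w (firstColumns d ∪ᴾ s)) (sym (combine-remQuot {n} w u)) u∈))
    where
    Infected : Fin (n * m) → Set
    Infected v = v ∈ infected (Grid n m) r (fromPattern n m p) t
    seed-cell : ∀ i x → T ((firstColumns d ∪ᴾ s) (toℕ x) (toℕ i)) → Infected (combine i (shiftCol c fits x))
    seed-cell i x = [ old , new ]′ ∘ to T-∨
      where
      old : T (toℕ x <ᵇ d) → Infected (combine i (shiftCol c fits x))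
      old x<d = before i (shiftCol c fits x)
                  (subst (_< c + d) (sym (toℕ-shiftCol c fits x)) (+-monoʳ-< c (<ᵇ⇒< _ _ x<d)))
      new : T (s (toℕ x) (toℕ i)) → Infected (combine i (shiftCol c fits x))
      new x∈s = ⊆-infected t (from (∈-fromPattern {n} {m} {p} i (shiftCol c fits x))
                  (subst (λ y → T (p y (toℕ i))) (sym (toℕ-shiftCol c fits x)) (s⊆p _ _ x∈s)))

  window-extends : ∀ {w} c d (fits : c + w ≤ m) s {hi t t′} → hi ≤ w →
                   InfectsFirstColumns r n w (firstColumns d ∪ᴾ s) t′ hi →
                   s ⊆ᴾ (λ x → p (c + x)) → InfectedBefore t (c + d) → InfectedBefore (t′ + t) (c + hi)
  window-extends {w} c d fits s {hi} {t} {t′} hi≤w window s⊆p before i j j<c+hi with toℕ j <? c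
  ... | yes j<c = infected-⊆-+ t′ (before i j (<-≤-trans j<c (m≤m+n c d)))
  ... | no  j≮c with shiftCol-preimage c fits j (≮⇒≥ j≮c) j<c+hi hi≤w
  ...   | x , refl , x<hi =
    subst (_∈ infected (Grid n m) r (fromPattern n m p) (t′ + t)) (shiftColumns-combine {n} c fits i x)
      (infected-embed (shiftColumns c fits n) (window-seeds c d fits s {t} s⊆p before) t′
        (window (from (∈-fromPattern {n} {w} {firstColumns hi} i x) (<⇒<ᵇ x<hi))))

  percolating : ∀ {t} → InfectedBefore t m → Percolating (Grid n m) r (fromPattern n m p)
  percolating {t} before v =
    t , subst (_∈ infected (Grid n m) r (fromPattern n m p) t) (combine-remQuot {n} m v) (before _ _ (toℕ<n _))

-- The seeds

pattern ● = true
pattern ○ = false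

column : Bool → Bool → Bool → Bool → ℕ → Bool
column a b c d 0 = a
column a b c d 1 = b
column a b c d 2 = c
column a b c d 3 = d
column a b c d _ = false

leftCap : Pattern
leftCap 0 = column ● ● ○ ●
leftCap 1 = column ● ○ ● ○
leftCap 2 = column ○ ○ ○ ●
leftCap _ = column ○ ○ ○ ○

block : Pattern
block 0 = column ● ○ ● ○
block 1 = column ○ ● ○ ●
block 2 = column ● ○ ○ ○
block 3 = column ○ ● ○ ●
block 4 = column ● ○ ● ○
block 5 = column ○ ○ ○ ●
block _ = column ○ ○ ○ ○

capWidth : Fin 6 → ℕ
capWidth ρ = suc (toℕ ρ)

rightCap : Fin 6 → Pattern
rightCap 0F 0 = column ● ● ● ●
rightCap 1F 0 = column ● ○ ● ○
rightCap 1F 1 = column ● ● ○ ●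
rightCap 2F 0 = column ● ○ ● ○
rightCap 2F 1 = column ○ ● ○ ●
rightCap 2F 2 = column ● ● ○ ●
rightCap 3F 0 = column ● ○ ● ○
rightCap 3F 1 = column ● ○ ○ ●
rightCap 3F 2 = column ○ ● ● ○
rightCap 3F 3 = column ● ● ○ ●
rightCap 4F 0 = column ● ○ ● ○
rightCap 4F 1 = column ○ ● ○ ●
rightCap 4F 2 = column ● ○ ○ ●
rightCap 4F 3 = column ○ ● ○ ○
rightCap 4F 4 = column ● ○ ● ●
rightCap 5F 0 = column ● ○ ● ○
rightCap 5F 1 = column ● ○ ○ ●
rightCap 5F 2 = column ○ ● ● ○
rightCap 5F 3 = column ● ○ ○ ●
rightCap 5F 4 = column ○ ● ○ ○
rightCap 5F 5 = column ● ○ ● ●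
rightCap _  _ = column ○ ○ ○ ○

blocks : ℕ → Pattern → Pattern
blocks zero    q = q
blocks (suc B) q = beside 6 block (blocks B q)

blocks-drop : ∀ k B q x → blocks (k + B) q (k * 6 + x) ≡ blocks B q x
blocks-drop zero    B q x = refl
blocks-drop (suc k) B q x = blocks-drop k B q x

blocks-drop-⊆ᴾ : ∀ k {B C} q → k + B ≡ C → blocks B q ⊆ᴾ (λ x → blocks C q (k * 6 + x))
blocks-drop-⊆ᴾ k q refl x i = subst T (sym (cong-app (blocks-drop k _ q x) i))

blocks-⊆ᴾ : ∀ {B B′} q → B ≤ B′ → blocks B ∅ᴾ ⊆ᴾ blocks B′ q
blocks-⊆ᴾ {zero}           q _           = ∅ᴾ-⊆ᴾ
blocks-⊆ᴾ {suc B} {suc B′} q (s≤s B≤B′) = beside-monoʳ 6 block (blocks-⊆ᴾ q B≤B′)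

cells-blocks : ∀ n B {v} q → cells n (B * 6 + v) (blocks B q) ≡ B * cells n 6 block + cells n v q
cells-blocks n zero    q = refl
cells-blocks n (suc B) {v} q = begin
  cells n (suc B * 6 + v) (blocks (suc B) q)            ≡⟨ cells-beside n 6 (B * 6 + v) block (blocks B q) ⟩
  cells n 6 block + cells n (B * 6 + v) (blocks B q)    ≡⟨ cong (cells n 6 block +_) (cells-blocks n B q) ⟩
  cells n 6 block + (B * cells n 6 block + cells n v q) ≡⟨ +-assoc (cells n 6 block) _ _ ⟨
  suc B * cells n 6 block + cells n v q                 ∎
  where open ≡-Reasoning

seedPattern : ℕ → Fin 6 → Pattern
seedPattern B ρ = beside 3 leftCap (blocks B (rightCap ρ))

seedWidth : ℕ → Fin 6 → ℕ
seedWidth B ρ = 3 + (B * 6 + capWidth ρ)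

seed : ∀ B ρ → Subset (4 * seedWidth B ρ)
seed B ρ = fromPattern 4 (seedWidth B ρ) (seedPattern B ρ)

capSize : Fin 6 → ℕ
capSize ρ = cells 4 (capWidth ρ) (rightCap ρ)

∣seed∣ : ∀ B ρ → ∣ seed B ρ ∣ ≡ 6 + (B * 10 + capSize ρ)
∣seed∣ B ρ = trans (∣fromPattern∣ 4 (seedWidth B ρ) (seedPattern B ρ))
  (trans (cells-beside 4 3 (B * 6 + capWidth ρ) leftCap (blocks B (rightCap ρ)))
         (cong (6 +_) (cells-blocks 4 B {capWidth ρ} (rightCap ρ))))

leftWindow : InfectsFirstColumns 3 4 9 (firstColumns 0 ∪ᴾ beside 3 leftCap (blocks 1 ∅ᴾ)) 3 6
leftWindow = toWitness {a? = _ ⊆? _} _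

middleWindow : InfectsFirstColumns 3 4 12 (firstColumns 3 ∪ᴾ blocks 2 ∅ᴾ) 3 9
middleWindow = toWitness {a? = _ ⊆? _} _

rightWindow : ∀ ρ → InfectsFirstColumns 3 4 (6 + capWidth ρ) (firstColumns 3 ∪ᴾ blocks 1 (rightCap ρ))
                                        5 (6 + capWidth ρ)
rightWindow = toWitness {a? = all? λ ρ → _ ⊆? _} _

shortSeed-fills : ∀ ρ → ⊤ ⊆ infected (Grid 4 (seedWidth 0 ρ)) 3 (seed 0 ρ) 5
shortSeed-fills = toWitness {a? = all? λ ρ → _ ⊆? _} _

module _ (K : ℕ) (ρ : Fin 6) where
  open Columns 4 (seedWidth (suc K) ρ) 3 (seedPattern (suc K) ρ)

  -- Block k occupies columns 3 + 6k to 8 + 6k; consecutive windows overlap in three columns.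
  Reached : ℕ → Set
  Reached k = ∃[ t ] InfectedBefore t (3 + k * 6 + 3)

  reached-first : Reached 0
  reached-first =
    3 , window-extends 0 0 (m≤m+n 9 (K * 6 + capWidth ρ)) (beside 3 leftCap (blocks 1 ∅ᴾ)) {6} {0} {3} (m≤m+n 6 3)
          leftWindow (beside-monoʳ 3 leftCap (blocks-⊆ᴾ {1} {suc K} (rightCap ρ) (s≤s z≤n))) (λ _ _ ())

  reached-next : ∀ k B → k + suc (suc B) ≡ suc K → Reached k → Reached (suc k)
  reached-next k B k+B≡ (t , before) = 3 + t ,
    subst (InfectedBefore (3 + t)) (next≡ k)
      (window-extends (3 + k * 6) 3 fits (blocks 2 ∅ᴾ) {9} {t} {3} (m≤m+n 9 3) middleWindow tail⊆ before)
    where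
    next≡ : ∀ k → 3 + k * 6 + 9 ≡ 3 + suc k * 6 + 3
    next≡ = solve-∀
    width≡ : ∀ k B c → 3 + ((k + suc (suc B)) * 6 + c) ≡ 3 + k * 6 + 12 + (B * 6 + c)
    width≡ = solve-∀
    fits : 3 + k * 6 + 12 ≤ seedWidth (suc K) ρ
    fits = subst (λ b → 3 + k * 6 + 12 ≤ 3 + (b * 6 + capWidth ρ)) k+B≡
             (subst (3 + k * 6 + 12 ≤_) (sym (width≡ k B (capWidth ρ))) (m≤m+n _ _))
    tail⊆ : blocks 2 ∅ᴾ ⊆ᴾ (λ x → seedPattern (suc K) ρ (3 + k * 6 + x))
    tail⊆ x i = blocks-drop-⊆ᴾ k (rightCap ρ) k+B≡ x i ∘ blocks-⊆ᴾ (rightCap ρ) (m≤m+n 2 B) x i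

  reached : ∀ k B → k + suc B ≡ suc K → Reached k
  reached zero    B _    = reached-first
  reached (suc k) B k+B≡ = reached-next k B k+B≡′ (reached k (suc B) k+B≡′)
    where k+B≡′ = trans (+-suc k (suc B)) k+B≡

  long-seed-percolates : Percolating (Grid 4 (seedWidth (suc K) ρ)) 3 (seed (suc K) ρ)
  long-seed-percolates = percolating {5 + t} (subst (InfectedBefore (5 + t)) (width≡ K (capWidth ρ)) filled)
    where
    width≡ : ∀ K c → 3 + K * 6 + (6 + c) ≡ 3 + (suc K * 6 + c)
    width≡ = solve-∀
    lastBlock = reached K 0 (+-comm K 1)
    t = proj₁ lastBlock
    filled : InfectedBefore (5 + t) (3 + K * 6 + (6 + capWidth ρ))
    filled = window-extends (3 + K * 6) 3 (≤-reflexive (width≡ K (capWidth ρ))) (blocks 1 (rightCap ρ))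
               {6 + capWidth ρ} {t} {5} ≤-refl (rightWindow ρ) (blocks-drop-⊆ᴾ K (rightCap ρ) (+-comm K 1))
               (proj₂ lastBlock)

seed-percolates : ∀ B ρ → Percolating (Grid 4 (seedWidth B ρ)) 3 (seed B ρ)
seed-percolates zero    ρ = ⊤⊆infected⇒percolating (Grid 4 (seedWidth 0 ρ)) 3 (seed 0 ρ) 5 (shortSeed-fills ρ)
seed-percolates (suc K) ρ = long-seed-percolates K ρ

-- Size of the seeds

[k*d+a]/d≡k+a/d : ∀ k a d .{{_ : NonZero d}} → (k * d + a) / d ≡ k + a / d
[k*d+a]/d≡k+a/d k a d = trans (+-distrib-/-∣ˡ a (divides k refl)) (cong (_+ a / d) (m*n/n≡m k d))

bound-seedWidth : ∀ B c → 5 * (3 + (B * 6 + c) + 1) / 3 ≡ B * 10 + 5 * (4 + c) / 3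
bound-seedWidth B c = trans (cong (_/ 3) (expand B c)) ([k*d+a]/d≡k+a/d (B * 10) (5 * (4 + c)) 3)
  where
  expand : ∀ B c → 5 * (3 + (B * 6 + c) + 1) ≡ B * 10 * 3 + 5 * (4 + c)
  expand = solve-∀

seed-percNumber : ∀ B ρ e → 6 + capSize ρ ≤ 5 * (4 + capWidth ρ) / 3 + e →
                  PercNumberAtMost (Grid 4 (seedWidth B ρ)) 3 (5 * (seedWidth B ρ + 1) / 3 + e)
seed-percNumber B ρ e cap≤ = seed B ρ , seed-percolates B ρ , (begin
  ∣ seed B ρ ∣                                ≡⟨ ∣seed∣ B ρ ⟩
  6 + (B * 10 + capSize ρ)                    ≡⟨ x∙yz≈y∙xz 6 (B * 10) (capSize ρ) ⟩
  B * 10 + (6 + capSize ρ)                    ≤⟨ +-monoʳ-≤ (B * 10) cap≤ ⟩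
  B * 10 + (5 * (4 + capWidth ρ) / 3 + e)     ≡⟨ +-assoc (B * 10) _ e ⟨
  B * 10 + 5 * (4 + capWidth ρ) / 3 + e       ≡⟨ cong (_+ e) (bound-seedWidth B (capWidth ρ)) ⟨
  5 * (seedWidth B ρ + 1) / 3 + e             ∎)
  where open ≤-Reasoning

capSize-bound : ∀ ρ → 6 + capSize ρ ≤ 5 * (4 + capWidth ρ) / 3 + 2
capSize-bound = toWitness {a? = all? λ ρ → _ ≤? _} _

seedWidth-onto : ∀ m → 4 ≤ m → ∃[ B ] ∃[ ρ ] seedWidth B ρ ≡ m
seedWidth-onto m 4≤m = n / 6 , fromℕ< (m%n<n n 6) , (begin
  3 + (n / 6 * 6 + suc (toℕ (fromℕ< (m%n<n n 6)))) ≡⟨ cong (λ q → 3 + (n / 6 * 6 + suc q)) (toℕ-fromℕ< _) ⟩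
  3 + (n / 6 * 6 + suc (n % 6))                     ≡⟨ cong (3 +_) (+-suc (n / 6 * 6) (n % 6)) ⟩
  4 + (n / 6 * 6 + n % 6)                           ≡⟨ cong (4 +_) (+-comm (n / 6 * 6) (n % 6)) ⟩
  4 + (n % 6 + n / 6 * 6)                           ≡⟨ cong (4 +_) (m≡m%n+[m/n]*n n 6) ⟨
  4 + n                                             ≡⟨ m+[n∸m]≡n 4≤m ⟩
  m                                                 ∎)
  where
  open ≡-Reasoning
  n = m ∸ 4

percNumber-Grid4 : ∀ m → 4 ≤ m → PercNumberAtMost (Grid 4 m) 3 (5 * (m + 1) / 3 + 2)
percNumber-Grid4 m 4≤m with B , ρ , refl ← seedWidth-onto m 4≤m = seed-percNumber B ρ 2 (capSize-bound ρ)

seed₇ : Subset (4 * 7)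
seed₇ = fromPattern 4 7 pattern₇
  where
  pattern₇ : Pattern
  pattern₇ 0 = column ● ● ○ ●
  pattern₇ 1 = column ○ ○ ● ○
  pattern₇ 2 = column ● ○ ○ ●
  pattern₇ 3 = column ○ ● ● ○
  pattern₇ 4 = column ● ○ ○ ●
  pattern₇ 5 = column ○ ● ○ ○
  pattern₇ 6 = column ● ○ ● ●
  pattern₇ _ = column ○ ○ ○ ○

seed₇-percolates : Percolating (Grid 4 7) 3 seed₇
seed₇-percolates = ⊤⊆infected⇒percolating (Grid 4 7) 3 seed₇ 4 (toWitness {a? = _ ⊆? _} _)

theorem5 : (m : ℕ) → 4 ≤ m →
    ((m ≡ 5 ⊎ m ≡ 7 ⊎ m ≡ 11) → PercNumberAtMost (Grid 4 m) 3 ((5 * (m + 1)) / 3 + 1))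
    × (¬ (m ≡ 5 ⊎ m ≡ 7 ⊎ m ≡ 11) → PercNumberAtMost (Grid 4 m) 3 ((5 * (m + 1)) / 3 + 2))
theorem5 m 4≤m = exceptional , λ _ → percNumber-Grid4 m 4≤m
  where
  exceptional : m ≡ 5 ⊎ m ≡ 7 ⊎ m ≡ 11 → PercNumberAtMost (Grid 4 m) 3 ((5 * (m + 1)) / 3 + 1)
  exceptional (inj₁ refl)        = seed-percNumber 0 1F 1 ≤-refl
  exceptional (inj₂ (inj₁ refl)) = seed₇ , seed₇-percolates , ≤-refl
  exceptional (inj₂ (inj₂ refl)) = seed-percNumber 1 1F 1 ≤-refl
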